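{- Let $a, b$ be positive integers with $2 \leq a \leq b$. Then $\mathcal{G}_{\mathcal{R}}(a,b) \leq a+b-1$.
   Context: A position is an unordered pair $(a,b)$ of nonnegative integers (pile sizes). $\mathcal{R}$-Wythoff: a move either removes a positive number of tokens from the larger pile (or from either pile if both piles have equal size), or removes the same positive number of tokens from both piles. $\mathcal{G}_{\mathcal{R}}$ is the Sprague-Grundy function of $\mathcal{R}$-Wythoff: $\mathcal{G}_{\mathcal{R}}(p)=\mathrm{mex}\{\mathcal{G}_{\mathcal{R}}(q): q \text{ reachable from } p \text{ in one move}\}$, where $\mathrm{mex}(S)$ is the least nonnegative integer not in $S$ and $\mathrm{mex}\{\}=0$. -}

module Defs where

open import Data.Nat using (ℕ; zero; suc; _+_; _∸_; _<ᵇ_; _≡ᵇ_; _⊓_)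
open import Data.Bool using (Bool; true; false; if_then_else_; _∨_)
open import Data.List using (List; []; _∷_; map; _++_; length; upTo)
open import Data.Bool.ListAction using (any)
open import Data.Product using (_×_; _,_)

memberᵇ : ℕ → List ℕ → Bool
memberᵇ n xs = any (n ≡ᵇ_) xs

mexSearch : List ℕ → ℕ → ℕ → ℕ
mexSearch xs n zero = n
mexSearch xs n (suc f) = if memberᵇ n xs then mexSearch xs (suc n) f else n

-- mex of a finite list: least natural not in it (it is ≤ length xs,
-- so a search with length xs + 1 steps suffices); mex [] = 0
mex : List ℕ → ℕ
mex xs = mexSearch xs 0 (suc (length xs))

oneTo : ℕ → List ℕ
oneTo n = map suc (upTo n)

-- R-Wythoff moves from the position with piles (a , b) (an unordered pair;
-- a representation as an ordered pair whose order is irrelevant).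
-- Single-pile moves: remove k ≥ 1 tokens from the larger pile, or from either
-- pile if both are equal.
singleMoves : ℕ → ℕ → List (ℕ × ℕ)
singleMoves a b with a <ᵇ b | b <ᵇ a
... | true  | _     = map (λ k → (a , b ∸ k)) (oneTo b)
... | false | true  = map (λ k → (a ∸ k , b)) (oneTo a)
... | false | false = map (λ k → (a , b ∸ k)) (oneTo b) ++ map (λ k → (a ∸ k , b)) (oneTo a)

diagMoves : ℕ → ℕ → List (ℕ × ℕ)
diagMoves a b = map (λ k → (a ∸ k , b ∸ k)) (oneTo (a ⊓ b))

moves : ℕ → ℕ → List (ℕ × ℕ)
moves a b = singleMoves a b ++ diagMoves a b

-- Sprague–Grundy value with fuel; every move decreases a + b by ≥ 1,
-- so fuel a + b suffices (at fuel 0 we have a = b = 0, value mex {} = 0).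
grundyFuel : ℕ → ℕ → ℕ → ℕ
grundyFuel zero a b = 0
grundyFuel (suc f) a b = mex (map (λ p → grundyFuel f (Data.Product.proj₁ p) (Data.Product.proj₂ p)) (moves a b))

GR : ℕ → ℕ → ℕ
GR a b = grundyFuel (a + b) a b

module Submission where

-- Every R-Wythoff move from (a , b) lowers the total a + b, so
-- by induction every Grundy value satisfies G(x , y) ≤ x + y.  For the
-- theorem we sharpen this to G(a , b) < a + b when a , b ≥ 2.  A move either
-- lowers the total by at least two (its value is then ≤ a + b - 2 by the
-- weak bound), or removes a single token from the larger pile, leading to
-- (a , b - 1) or (a - 1 , b); there both piles are still ≥ 2 unless
-- (a , b) = (2 , 2), so induction gives a value < a + b - 1.  Hence every
-- option value is < a + b - 1 and the mex is ≤ a + b - 1.  The base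
-- position (2 , 2) is evaluated directly: G(2 , 2) = 1.
--
-- Grundy values are computed with fuel, so the
-- bounds are stated for every fuel that suffices (at least the total).

open import Defs
open import Data.Nat using (ℕ; _+_; _∸_; _≤_)
open import Data.Nat using (zero; suc; _<_; _<ᵇ_; _≡ᵇ_; _⊓_; z≤n; s≤s)
open import Data.Nat.Properties
open import Data.Bool using (true; false; T)
open import Data.List using (_∷_; map; length)
open import Data.List.Membership.Propositional using (_∈_)
open import Data.List.Membership.Propositional.Properties using (∈-map⁻; ∈-++⁻; ∈-upTo⁻)
open import Data.List.Relation.Unary.Any using (here; there)
open import Data.Product using (_×_; _,_; proj₁; proj₂; ∃-syntax)
open import Data.Sum using (inj₁; inj₂)
open import Relation.Nullary using (yes; no; contradiction)
open import Relation.Nullary.Decidable using (_×-dec_)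
open import Relation.Binary.PropositionalEquality

memberᵇ-sound : ∀ n xs → T (memberᵇ n xs) → n ∈ xs
memberᵇ-sound n (x ∷ xs) h with n ≡ᵇ x in eq
... | true  = here (≡ᵇ⇒≡ n x (subst T (sym eq) _))
... | false = there (memberᵇ-sound n xs h)

-- If every element of xs is below v then mex xs ≤ v: the search for a
-- missing value cannot pass v, since v itself is missing.
mex≤ : ∀ xs v → (∀ z → z ∈ xs → z < v) → mex xs ≤ v
mex≤ xs v below = search 0 (suc (length xs)) z≤n
  where
  search : ∀ n fuel → n ≤ v → mexSearch xs n fuel ≤ v
  search n zero       n≤v = n≤v
  search n (suc fuel) n≤v with memberᵇ n xs in eq
  ... | true  = search (suc n) fuel (below n (memberᵇ-sound n xs (subst T (sym eq) _)))
  ... | false = n≤v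

-- The shape of an option (x , y) of (a , b): either the total drops by at
-- least two, or one token is taken from the second pile while it is the
-- larger one, or one token from the first pile while it is the larger one.
data Option : ℕ → ℕ → ℕ × ℕ → Set where
  far    : ∀ {a b x y} → 2 + (x + y) ≤ a + b → Option a b (x , y)
  nearR  : ∀ {a y} → a ≤ suc y → Option a (suc y) (a , y)
  nearL  : ∀ {x b} → b ≤ suc x → Option (suc x) b (x , b)

option-total< : ∀ {a b x y} → Option a b (x , y) → x + y < a + b
option-total< (far h)           = ≤-trans (n≤1+n _) h
option-total< (nearR {a} {y} _) = +-monoʳ-< a (n<1+n y)
option-total< (nearL _)         = ≤-refl

∈-amounts : ∀ {A : Set} (g : ℕ → A) n {p} → p ∈ map g (oneTo n) → ∃[ k ] (k < n × p ≡ g (suc k))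
∈-amounts g n p∈ with ∈-map⁻ g p∈
... | _ , k∈ , refl with ∈-map⁻ suc k∈
...   | k , k∈upTo , refl = k , ∈-upTo⁻ k∈upTo , refl

takeSecond : ∀ a b k → a ≤ b → k < b → Option a b (a , b ∸ suc k)
takeSecond a (suc b) zero a≤b _ = nearR a≤b
takeSecond a (suc zero) (suc k) _ (s≤s ())
takeSecond a (suc (suc b)) (suc k) _ _ = far total
  where
  total : 2 + (a + (b ∸ k)) ≤ a + suc (suc b)
  total rewrite +-suc a (suc b) | +-suc a b = s≤s (s≤s (+-monoʳ-≤ a (m∸n≤m b k)))

takeFirst : ∀ a b k → b ≤ a → k < a → Option a b (a ∸ suc k , b)
takeFirst (suc a) b zero b≤a _ = nearL b≤a
takeFirst (suc zero) b (suc k) _ (s≤s ())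
takeFirst (suc (suc a)) b (suc k) _ _ = far (s≤s (s≤s (+-monoˡ-≤ b (m∸n≤m a k))))

takeBoth : ∀ a b k → k < a → k < b → Option a b (a ∸ suc k , b ∸ suc k)
takeBoth (suc a) (suc b) k _ _ = far (s≤s total)
  where
  total : suc (a ∸ k + (b ∸ k)) ≤ a + suc b
  total rewrite +-suc a b = s≤s (+-mono-≤ (m∸n≤m a k) (m∸n≤m b k))

second-options : ∀ {a b p} → a ≤ b → p ∈ map (λ k → (a , b ∸ k)) (oneTo b) → Option a b p
second-options {a} {b} a≤b p∈ with ∈-amounts (λ k → (a , b ∸ k)) b p∈
... | k , k<b , refl = takeSecond a b k a≤b k<b

first-options : ∀ {a b p} → b ≤ a → p ∈ map (λ k → (a ∸ k , b)) (oneTo a) → Option a b p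
first-options {a} {b} b≤a p∈ with ∈-amounts (λ k → (a ∸ k , b)) a p∈
... | k , k<a , refl = takeFirst a b k b≤a k<a

move-option : ∀ a b {p} → p ∈ moves a b → Option a b p
move-option a b p∈ with ∈-++⁻ (singleMoves a b) p∈
move-option a b p∈ | inj₂ p∈diag with ∈-amounts (λ k → (a ∸ k , b ∸ k)) (a ⊓ b) p∈diag
... | k , k<a⊓b , refl =
  takeBoth a b k (<-≤-trans k<a⊓b (m⊓n≤m a b)) (<-≤-trans k<a⊓b (m⊓n≤n a b))
move-option a b p∈ | inj₁ p∈single with a <ᵇ b in a<b | b <ᵇ a in b<a
... | true  | _    = second-options (<⇒≤ (<ᵇ⇒< a b (subst T (sym a<b) _))) p∈single
... | false | true = first-options (<⇒≤ (<ᵇ⇒< b a (subst T (sym b<a) _))) p∈single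
... | false | false with ∈-++⁻ (map (λ k → (a , b ∸ k)) (oneTo b)) p∈single
...   | inj₁ p∈ = second-options (≮⇒≥ (λ lt → subst T b<a (<⇒<ᵇ lt))) p∈
...   | inj₂ p∈ = first-options (≮⇒≥ (λ lt → subst T a<b (<⇒<ᵇ lt))) p∈

option-value : ∀ f a b {z} →
  z ∈ map (λ p → grundyFuel f (proj₁ p) (proj₂ p)) (moves a b) →
  ∃[ x ] ∃[ y ] (Option a b (x , y) × z ≡ grundyFuel f x y)
option-value f a b z∈ with ∈-map⁻ (λ p → grundyFuel f (proj₁ p) (proj₂ p)) z∈
... | (x , y) , p∈ , refl = x , y , move-option a b p∈ , refl

grundy≤total : ∀ f x y → x + y ≤ f → grundyFuel f x y ≤ x + y
grundy≤total zero    x y _ = z≤n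
grundy≤total (suc f) x y total≤ = mex≤ _ (x + y) below
  where
  below : ∀ z → z ∈ map (λ p → grundyFuel f (proj₁ p) (proj₂ p)) (moves x y) → z < x + y
  below z z∈ with option-value f x y z∈
  ... | x′ , y′ , opt , refl =
    let smaller = option-total< opt
    in ≤-<-trans (grundy≤total f x′ y′ (≤-pred (≤-trans smaller total≤))) smaller

-- The base position: G(2 , 2) = 1 (its options have values 0 and 2).
grundy-2-2 : ∀ f → 4 ≤ f → grundyFuel f 2 2 ≡ 1
grundy-2-2 1 (s≤s ())
grundy-2-2 2 (s≤s (s≤s ()))
grundy-2-2 3 (s≤s (s≤s (s≤s ())))
grundy-2-2 4 _ = refl
grundy-2-2 (suc (suc (suc (suc (suc f))))) _ = refl

grundy<total : ∀ f a b → 2 ≤ a → 2 ≤ b → a + b ≤ f → grundyFuel f a b < a + b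
grundy<total f (suc zero) b (s≤s ()) _ _
grundy<total f (suc (suc a)) b _ 2≤b total≤ with (a ≟ 0) ×-dec (b ≟ 2)
... | yes (refl , refl) rewrite grundy-2-2 f total≤ = s≤s (s≤s z≤n)
grundy<total zero (suc (suc a)) b _ _ () | no _
grundy<total (suc f) (suc (suc a)) b _ 2≤b total≤ | no not-2-2 =
  s≤s (mex≤ _ (suc (a + b)) below)
  where
  -- every option value is below (2 + a) + b - 1; the two near moves use
  -- the induction hypothesis, which applies since (2 + a , b) ≠ (2 , 2)
  below : ∀ z → z ∈ map (λ p → grundyFuel f (proj₁ p) (proj₂ p)) (moves (suc (suc a)) b) →
          z < suc (a + b)
  below z z∈ with option-value f (suc (suc a)) b z∈
  ... | x , y , far h , refl =
    ≤-trans (s≤s (grundy≤total f x y (≤-pred (≤-trans (n≤1+n _) (≤-trans h total≤))))) (≤-pred h)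
  ... | _ , zero , nearR _ , refl = contradiction 2≤b λ { (s≤s ()) }
  ... | _ , suc zero , nearR a≤0 , refl =
    contradiction (n≤0⇒n≡0 (≤-pred (≤-pred a≤0)) , refl) not-2-2
  ... | _ , suc (suc y) , nearR _ , refl =
    subst (z <_) (sym shift)
      (grundy<total f (suc (suc a)) (suc (suc y)) (s≤s (s≤s z≤n)) (s≤s (s≤s z≤n))
        (≤-pred (subst (_≤ suc f) (cong suc shift) total≤)))
    where
    shift : suc (a + suc (suc (suc y))) ≡ suc (suc a) + suc (suc y)
    shift = cong suc (+-suc a (suc (suc y)))
  ... | _ , _ , nearL b≤2+a , refl with a ≟ 0
  ...   | yes a≡0 =
    contradiction (a≡0 , ≤-antisym (subst (λ n → b ≤ suc (suc n)) a≡0 b≤2+a) 2≤b) not-2-2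
  ...   | no a≢0 = grundy<total f (suc a) b (s≤s (n≢0⇒n>0 a≢0)) 2≤b (≤-pred total≤)

theorem2p14 : (a b : ℕ) → 2 ≤ a → a ≤ b → GR a b ≤ a + b ∸ 1
theorem2p14 (suc zero) b (s≤s ()) _
theorem2p14 (suc (suc a)) b 2≤a a≤b =
  <⇒≤pred (grundy<total _ (suc (suc a)) b 2≤a (≤-trans 2≤a a≤b) ≤-refl)
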